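{- For every integer $n\ge 1$, the pentagonal stacked prism $Y_{5,n}$ is odd prime.
   Context: All graphs are finite and simple. An odd prime labeling of a graph $G$ with $N$ vertices is a bijection $\ell:V(G)\to\{1,3,\dots,2N-1\}$ such that $\gcd(\ell(u),\ell(v))=1$ for every edge $uv$; $G$ is odd prime if it has one. For $k\ge 3$, $n\ge 1$, the stacked prism $Y_{k,n}$ is the Cartesian product $C_k\,\square\,P_n$ of the cycle on $k$ vertices with the path on $n$ vertices: its vertices are $v_{i,j}$ ($1\le i\le n$, $1\le j\le k$), with edges $v_{i,j}v_{i,j+1}$ ($1\le j\le k-1$) and $v_{i,k}v_{i,1}$ for each $i$, and $v_{i,j}v_{i+1,j}$ for $1\le i\le n-1$, $1\le j\le k$. -}

module Defs where

open import Data.Nat using (ℕ; suc; _+_; _*_)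
open import Data.Nat.GCD using (gcd)
open import Data.Fin using (Fin; toℕ)
open import Data.Product using (_×_; _,_)
open import Data.Sum using (_⊎_)
open import Function.Bundles using (_⤖_; Bijection)
open import Relation.Binary.PropositionalEquality using (_≡_)

-- Stacked prism Y_{k,n} = C_k □ P_n.
-- Vertex v_{i,j} (1 ≤ i ≤ n, 1 ≤ j ≤ k) is represented as (i-1 , j-1) : Fin n × Fin k.
YVertex : ℕ → ℕ → Set
YVertex k n = Fin n × Fin k

data YEdge (k n : ℕ) : YVertex k n → YVertex k n → Set where
  cyc  : ∀ {i j j′} → suc (toℕ j) ≡ toℕ j′ → YEdge k n (i , j) (i , j′)
  wrap : ∀ {i j j′} → suc (toℕ j) ≡ k → toℕ j′ ≡ 0 → YEdge k n (i , j) (i , j′)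
  vert : ∀ {i i′ j} → suc (toℕ i) ≡ toℕ i′ → YEdge k n (i , j) (i′ , j)

YAdj : (k n : ℕ) → YVertex k n → YVertex k n → Set
YAdj k n u v = YEdge k n u v ⊎ YEdge k n v u

-- The odd label set {1,3,…,2N-1} is identified with Fin N via m ↦ 2m+1.
oddOf : ∀ {N} → Fin N → ℕ
oddOf m = 2 * toℕ m + 1

record OddPrimeLabeling (k n : ℕ) : Set where
  field
    ℓ      : YVertex k n ⤖ Fin (k * n)
    coprime : ∀ u v → YAdj k n u v →
              gcd (oddOf (Bijection.to ℓ u)) (oddOf (Bijection.to ℓ v)) ≡ 1

IsOddPrimeY : ℕ → ℕ → Set
IsOddPrimeY k n = OddPrimeLabeling k n

{-# OPTIONS --safe #-}

-- Two odd numbers differing by a power of two are coprime, since a common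
-- divisor divides both an odd number and a power of two. So it suffices to
-- number the vertices 0, …, 5n−1 (number m gives label 2m+1) so that
-- adjacent vertices get numbers differing by a power of two. Row i receives
-- the block 5i + τ(j + 2i mod 5), where the base row τ = (0, 1, 3, 4, 2)
-- has cyclic gaps 1, 2, 1, 2, 2 and the vertical gaps 5 + τ(j+2) − τ(j)
-- are 8, 8, 4, 1, 4.
module Submission where

open import Defs
open import Data.Nat using (ℕ; _≥_; zero; suc; _+_; _*_; _^_)
open import Data.Nat.Properties using (+-assoc; *-comm; <⇒≢)
open import Data.Nat.Divisibility using (∣1⇒≡1; ∣m+n∣m⇒∣n; ∣-trans; m∣m*n)
open import Data.Nat.Coprimality as Coprime using (Coprime; coprime-divisor; coprime⇒gcd≡1)
open import Data.Nat.Tactic.RingSolver using (solve-∀)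
open import Data.Fin using (Fin; toℕ; combine)
open import Data.Fin.Patterns using (0F; 1F; 2F; 3F; 4F)
open import Data.Fin.Properties using (toℕ-cast; toℕ-combine; toℕ-injective; toℕ<n; *↔×)
open import Data.Fin.Permutation
  using (Permutation′; permutation; _⟨$⟩ʳ_; _⟨$⟩ˡ_; inverseˡ; inverseʳ; id; _∘ₚ_; cast-id)
open import Data.Product using (_×_; _,_; ∃-syntax)
open import Data.Sum using (_⊎_; inj₁; inj₂)
open import Data.Empty using (⊥-elim)
open import Function.Base using (_∘_)
open import Function.Bundles using (_↔_; _⤖_; Bijection; mk↔ₛ′)
open import Function.Construct.Composition using (_↔-∘_)
open import Function.Construct.Symmetry using (↔-sym)
open import Function.Properties.Inverse using (↔⇒⤖)
open import Relation.Binary.PropositionalEquality using (_≡_; refl; sym; trans; cong; subst; subst₂)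

2-coprimeTo-odd : ∀ x → Coprime 2 (2 * x + 1)
2-coprimeTo-odd x (d∣2 , d∣odd) = ∣1⇒≡1 (∣m+n∣m⇒∣n d∣odd (∣-trans d∣2 (m∣m*n x)))

2^-coprimeTo-odd : ∀ k x → Coprime (2 ^ k) (2 * x + 1)
2^-coprimeTo-odd zero    x (d∣1 , _) = ∣1⇒≡1 d∣1
2^-coprimeTo-odd (suc k) x {d} (d∣2^[1+k] , d∣odd) =
  2^-coprimeTo-odd k x (coprime-divisor d-coprimeTo-2 d∣2^[1+k] , d∣odd)
  where
  d-coprimeTo-2 : Coprime d 2
  d-coprimeTo-2 (e∣d , e∣2) = 2-coprimeTo-odd x (e∣2 , ∣-trans e∣d d∣odd)

odd-coprimeTo-+2^ : ∀ x k → Coprime (2 * x + 1) (2 * x + 1 + 2 ^ k)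
odd-coprimeTo-+2^ x k (d∣odd , d∣sum) = 2^-coprimeTo-odd k x (∣m+n∣m⇒∣n d∣sum d∣odd , d∣odd)

odd-coprimeTo-odd[+2^] : ∀ x k → Coprime (2 * x + 1) (2 * (x + 2 ^ k) + 1)
odd-coprimeTo-odd[+2^] x k = subst (Coprime _) (sym (double-+ x (2 ^ k))) (odd-coprimeTo-+2^ x (suc k))
  where
  double-+ : ∀ x t → 2 * (x + t) + 1 ≡ 2 * x + 1 + 2 * t
  double-+ = solve-∀

PowerOfTwoApart : ℕ → ℕ → Set
PowerOfTwoApart p q = ∃[ k ] (q ≡ p + 2 ^ k ⊎ p ≡ q + 2 ^ k)

powerOfTwoApart-+ˡ : ∀ c {p q} → PowerOfTwoApart p q → PowerOfTwoApart (c + p) (c + q)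
powerOfTwoApart-+ˡ c {p}     (k , inj₁ refl) = k , inj₁ (sym (+-assoc c p (2 ^ k)))
powerOfTwoApart-+ˡ c {q = q} (k , inj₂ refl) = k , inj₂ (sym (+-assoc c q (2 ^ k)))

powerOfTwoApart⇒coprime-odd : ∀ {p q} → PowerOfTwoApart p q → Coprime (2 * p + 1) (2 * q + 1)
powerOfTwoApart⇒coprime-odd {p}     (k , inj₁ refl) = odd-coprimeTo-odd[+2^] p k
powerOfTwoApart⇒coprime-odd {q = q} (k , inj₂ refl) = Coprime.sym (odd-coprimeTo-odd[+2^] q k)

powerOfTwoGaps⇒oddPrime : ∀ {k n} (ℓ : YVertex k n ⤖ Fin (k * n)) →
  (∀ {u v} → YEdge k n u v →
     PowerOfTwoApart (toℕ (Bijection.to ℓ u)) (toℕ (Bijection.to ℓ v))) →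
  OddPrimeLabeling k n
powerOfTwoGaps⇒oddPrime ℓ gaps = record
  { ℓ       = ℓ
  ; coprime = λ where
      _ _ (inj₁ uv) → coprime⇒gcd≡1 (powerOfTwoApart⇒coprime-odd (gaps uv))
      _ _ (inj₂ vu) → coprime⇒gcd≡1 (Coprime.sym (powerOfTwoApart⇒coprime-odd (gaps vu)))
  }

permuteRows : ∀ {k n} → (Fin n → Permutation′ k) → (Fin n × Fin k) ↔ (Fin n × Fin k)
permuteRows σ = mk↔ₛ′
  (λ (i , j) → i , σ i ⟨$⟩ʳ j)
  (λ (i , j) → i , σ i ⟨$⟩ˡ j)
  (λ (i , j) → cong (i ,_) (inverseʳ (σ i)))
  (λ (i , j) → cong (i ,_) (inverseˡ (σ i)))

rowMajorLabelling : ∀ {k n} → (Fin n → Permutation′ k) → YVertex k n ⤖ Fin (k * n)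
rowMajorLabelling {k} {n} σ = ↔⇒⤖ (cast-id (*-comm n k) ↔-∘ (↔-sym *↔× ↔-∘ permuteRows σ))

rowMajorIndex : ∀ {k n} → (Fin n → Permutation′ k) → YVertex k n → ℕ
rowMajorIndex {k} σ (i , j) = k * toℕ i + toℕ (σ i ⟨$⟩ʳ j)

toℕ-rowMajorLabelling : ∀ {k n} (σ : Fin n → Permutation′ k) v →
  toℕ (Bijection.to (rowMajorLabelling σ) v) ≡ rowMajorIndex σ v
toℕ-rowMajorLabelling {k} {n} σ (i , j) =
  trans (toℕ-cast (*-comm n k) (combine i (σ i ⟨$⟩ʳ j))) (toℕ-combine i (σ i ⟨$⟩ʳ j))

rowMajorLabelling-oddPrime : ∀ {k n} (σ : Fin n → Permutation′ k) →
  (∀ {u v} → YEdge k n u v → PowerOfTwoApart (rowMajorIndex σ u) (rowMajorIndex σ v)) →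
  OddPrimeLabeling k n
rowMajorLabelling-oddPrime σ gaps = powerOfTwoGaps⇒oddPrime (rowMajorLabelling σ) λ {u} {v} uv →
  subst₂ PowerOfTwoApart (sym (toℕ-rowMajorLabelling σ u)) (sym (toℕ-rowMajorLabelling σ v)) (gaps uv)

next : Permutation′ 5
next = permutation
  (λ { 0F → 1F ; 1F → 2F ; 2F → 3F ; 3F → 4F ; 4F → 0F })
  (λ { 0F → 4F ; 1F → 0F ; 2F → 1F ; 3F → 2F ; 4F → 3F })
  (λ { 0F → refl ; 1F → refl ; 2F → refl ; 3F → refl ; 4F → refl })
  (λ { 0F → refl ; 1F → refl ; 2F → refl ; 3F → refl ; 4F → refl })

successor⇒next : ∀ {j j′ : Fin 5} → suc (toℕ j) ≡ toℕ j′ → next ⟨$⟩ʳ j ≡ j′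
successor⇒next {0F}      eq = toℕ-injective eq
successor⇒next {1F}      eq = toℕ-injective eq
successor⇒next {2F}      eq = toℕ-injective eq
successor⇒next {3F}      eq = toℕ-injective eq
successor⇒next {4F} {j′} eq = ⊥-elim (<⇒≢ (toℕ<n j′) (sym eq))

wrap⇒next : ∀ {j j′ : Fin 5} → suc (toℕ j) ≡ 5 → toℕ j′ ≡ 0 → next ⟨$⟩ʳ j ≡ j′
wrap⇒next {0F} ()
wrap⇒next {1F} ()
wrap⇒next {2F} ()
wrap⇒next {3F} ()
wrap⇒next {4F} _ j′≡0 = toℕ-injective (sym j′≡0)

shiftBy : ℕ → Permutation′ 5
shiftBy zero    = id
shiftBy (suc r) = shiftBy r ∘ₚ next ∘ₚ next

shiftBy-next : ∀ r j → shiftBy r ⟨$⟩ʳ (next ⟨$⟩ʳ j) ≡ next ⟨$⟩ʳ (shiftBy r ⟨$⟩ʳ j)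
shiftBy-next zero    j = refl
shiftBy-next (suc r) j = cong (λ x → next ⟨$⟩ʳ (next ⟨$⟩ʳ x)) (shiftBy-next r j)

baseRow : Permutation′ 5
baseRow = permutation
  (λ { 0F → 0F ; 1F → 1F ; 2F → 3F ; 3F → 4F ; 4F → 2F })
  (λ { 0F → 0F ; 1F → 1F ; 2F → 4F ; 3F → 2F ; 4F → 3F })
  (λ { 0F → refl ; 1F → refl ; 2F → refl ; 3F → refl ; 4F → refl })
  (λ { 0F → refl ; 1F → refl ; 2F → refl ; 3F → refl ; 4F → refl })

baseRow-next-apart : ∀ x →
  PowerOfTwoApart (toℕ (baseRow ⟨$⟩ʳ x)) (toℕ (baseRow ⟨$⟩ʳ (next ⟨$⟩ʳ x)))
baseRow-next-apart 0F = 0 , inj₁ refl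
baseRow-next-apart 1F = 1 , inj₁ refl
baseRow-next-apart 2F = 0 , inj₁ refl
baseRow-next-apart 3F = 1 , inj₂ refl
baseRow-next-apart 4F = 1 , inj₂ refl

baseRow-next²-apart : ∀ x →
  PowerOfTwoApart (toℕ (baseRow ⟨$⟩ʳ x)) (5 + toℕ (baseRow ⟨$⟩ʳ (next ⟨$⟩ʳ (next ⟨$⟩ʳ x))))
baseRow-next²-apart 0F = 3 , inj₁ refl
baseRow-next²-apart 1F = 3 , inj₁ refl
baseRow-next²-apart 2F = 2 , inj₁ refl
baseRow-next²-apart 3F = 0 , inj₁ refl
baseRow-next²-apart 4F = 2 , inj₁ refl

pentagonRow : ℕ → Permutation′ 5
pentagonRow i = shiftBy i ∘ₚ baseRow

pentagonLabel : ℕ → Fin 5 → ℕ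
pentagonLabel i j = 5 * i + toℕ (pentagonRow i ⟨$⟩ʳ j)

pentagonLabel-next : ∀ i j → PowerOfTwoApart (pentagonLabel i j) (pentagonLabel i (next ⟨$⟩ʳ j))
pentagonLabel-next i j =
  subst (λ x → PowerOfTwoApart (pentagonLabel i j) (5 * i + toℕ (baseRow ⟨$⟩ʳ x)))
    (sym (shiftBy-next i j))
    (powerOfTwoApart-+ˡ (5 * i) (baseRow-next-apart (shiftBy i ⟨$⟩ʳ j)))

pentagonLabel-suc : ∀ i j → PowerOfTwoApart (pentagonLabel i j) (pentagonLabel (suc i) j)
pentagonLabel-suc i j =
  subst (PowerOfTwoApart (pentagonLabel i j)) (next-row i _)
    (powerOfTwoApart-+ˡ (5 * i) (baseRow-next²-apart (shiftBy i ⟨$⟩ʳ j)))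
  where
  next-row : ∀ i y → 5 * i + (5 + y) ≡ 5 * suc i + y
  next-row = solve-∀

pentagonGaps : ∀ {n u v} → YEdge 5 n u v →
  PowerOfTwoApart (rowMajorIndex (pentagonRow ∘ toℕ) u) (rowMajorIndex (pentagonRow ∘ toℕ) v)
pentagonGaps (cyc {i} s) =
  subst (PowerOfTwoApart _ ∘ pentagonLabel (toℕ i)) (successor⇒next s) (pentagonLabel-next (toℕ i) _)
pentagonGaps (wrap {i} s z) =
  subst (PowerOfTwoApart _ ∘ pentagonLabel (toℕ i)) (wrap⇒next s z) (pentagonLabel-next (toℕ i) _)
pentagonGaps (vert {i} {j = j} s) =
  subst (λ t → PowerOfTwoApart _ (pentagonLabel t j)) s (pentagonLabel-suc (toℕ i) j)

mainTheorem7 : (n : ℕ) → n ≥ 1 → IsOddPrimeY 5 n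
mainTheorem7 n _ = rowMajorLabelling-oddPrime (pentagonRow ∘ toℕ) pentagonGaps
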